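{- Let $n$ be an even integer and let $G$ be a $3$-partite graph on $n$ vertices. Then there exists a partition $V(G)=A\cup B$ with $|A|=|B|=n/2$ such that $e(A)\leq n^2/16$ and $e(B)\leq n^2/16$.
   Context: A graph is $3$-partite if its vertex set can be partitioned into three independent sets. For $S\subseteq V(G)$, $e(S)$ denotes the number of edges of $G$ with both endpoints in $S$. -}

module Defs where

open import Data.Nat using (ℕ; zero; suc; _+_; _<?_)
open import Data.Bool using (Bool; true; false; _∧_; T)
open import Data.Fin using (Fin; toℕ)
open import Data.Fin.Subset using (Subset; _∈_)
open import Data.Fin.Subset.Properties using (_∈?_)
open import Data.List using (List; map)
open import Data.Nat.ListAction using (sum)
open import Data.Fin.Base using ()
open import Data.List using (allFin)
open import Data.Product using (Σ; _×_)
open import Relation.Nullary using (¬_)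
open import Relation.Nullary.Decidable using (⌊_⌋)
open import Relation.Binary.PropositionalEquality using (_≡_)

record Graph (n : ℕ) : Set where
  field
    adj   : Fin n → Fin n → Bool
    sym   : ∀ i j → adj i j ≡ adj j i
    irrefl : ∀ i → adj i i ≡ false

open Graph public

ThreePartite : ∀ {n} → Graph n → Set
ThreePartite {n} G =
  Σ (Fin n → Fin 3) λ c → ∀ i j → T (adj G i j) → ¬ (c i ≡ c j)

-- e(S): number of edges with both endpoints in S, counting each edge
-- {i, j} once via the pair with toℕ i < toℕ j.
edgesIn : ∀ {n} → Graph n → Subset n → ℕ
edgesIn {n} G S =
  sum (map (λ i → sum (map (λ j → count i j) (allFin n))) (allFin n))
  where
  count : Fin n → Fin n → ℕ
  count i j with ⌊ toℕ i <? toℕ j ⌋ ∧ ⌊ i ∈? S ⌋ ∧ ⌊ j ∈? S ⌋ ∧ adj G i j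
  ... | true  = 1
  ... | false = 0

-- A proper 3-colouring has at most one colour class with more than n/2 vertices,
-- so there are two colours u and w whose classes have at most n/2 vertices each.
-- Let A be the class of u topped up to n/2 vertices by vertices of the third
-- colour: A misses colour w and its complement misses u. A vertex set S missing a
-- colour is bipartite, with sides of sizes x + y = |S|, so it spans at most
-- xy ≤ |S|²/4 = n²/16 edges.

module Submission where

open import Defs
open import Data.Nat using (ℕ; _+_; _*_; _≤_; _≰_)
open import Data.Fin.Subset using (Subset; ∁; ∣_∣)
open import Data.Product using (Σ; _×_)
open import Relation.Binary.PropositionalEquality using (_≡_)

open import Data.Nat.Properties hiding (_≟_)
open import Algebra.Properties.Semiring.Sum +-*-semiring
  using (sum-syntax; ∑-distrib-+; ∑-comm; *-distribˡ-sum; *-distribʳ-sum; sum-cong-≗)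
open import Data.Bool using (Bool; true; false; _∧_; not; T)
open import Data.Bool.Properties using (T-≡)
open import Data.Empty using (⊥; ⊥-elim)
open import Data.Fin using (Fin; zero; suc; toℕ; _≟_; punchIn)
open import Data.Fin.Patterns using (0F; 1F; 2F)
open import Data.Fin.Properties using (punchOut-injective; punchInᵢ≢i)
open import Data.Fin.Subset using (_∈_; _⊆_; inside; outside)
open import Data.Fin.Subset.Properties
  using (_∈?_; ⊆-refl; drop-∷-⊆; s⊆s; out⊆; p⊆q⇒∣p∣≤∣q∣; ∣∁p∣≡n∸∣p∣; ∣p∣≤n; x∉p⇒x∈∁p; x∈∁p⇒x∉p)
open import Data.List using (map; tabulate; allFin)
open import Data.List.Properties using (map-cong)
import Data.Nat.ListAction as List
open import Data.Nat using (zero; suc; z≤n; s≤s; _<?_; _≤?_; _∸_)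
open import Data.Nat.Tactic.RingSolver using (solve-∀)
open import Data.Product using (_,_)
open import Data.Sum using (inj₁; inj₂)
import Data.Vec as Vec
open import Data.Vec using ([]; _∷_; here)
open import Data.Vec.Properties using (lookup⇒[]=; []=⇒lookup; lookup∘tabulate)
open import Function using (_∘_; id)
open import Function.Bundles using (Equivalence)
open import Relation.Nullary using (yes; no)
open import Relation.Nullary.Decidable using (⌊_⌋; toWitness; fromWitness; ⌊⌋-map′)
open import Relation.Binary.PropositionalEquality
  using (refl; cong; cong₂; subst; subst₂; _≢_; module ≡-Reasoning)
import Relation.Binary.PropositionalEquality as ≡

𝟙 : Bool → ℕ
𝟙 true  = 1
𝟙 false = 0

sum-map-tabulate : ∀ {A : Set} {n} (f : A → ℕ) (g : Fin n → A) →
  List.sum (map f (tabulate g)) ≡ ∑[ i < n ] f (g i)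
sum-map-tabulate {n = zero}  f g = refl
sum-map-tabulate {n = suc n} f g = cong (f (g zero) +_) (sum-map-tabulate f (g ∘ suc))

∑-mono-≤ : ∀ {n} {f g : Fin n → ℕ} → (∀ i → f i ≤ g i) → ∑[ i < n ] f i ≤ ∑[ i < n ] g i
∑-mono-≤ {zero}  f≤g = z≤n
∑-mono-≤ {suc n} f≤g = +-mono-≤ (f≤g zero) (∑-mono-≤ (f≤g ∘ suc))

∑∑-product : ∀ {m n} (f : Fin m → ℕ) (g : Fin n → ℕ) →
  ∑[ i < m ] ∑[ j < n ] (f i * g j) ≡ (∑[ i < m ] f i) * (∑[ j < n ] g j)
∑∑-product f g = ≡.sym (≡.trans (*-distribʳ-sum _ f)
  (sum-cong-≗ λ i → *-distribˡ-sum (f i) g))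

∑𝟙∈-∷ : ∀ {n} s (p : Subset n) → ∑[ i < n ] 𝟙 ⌊ suc i ∈? s ∷ p ⌋ ≡ ∑[ i < n ] 𝟙 ⌊ i ∈? p ⌋
∑𝟙∈-∷ s p = sum-cong-≗ λ i → cong 𝟙 (⌊⌋-map′ _ _ (i ∈? p))

∣p∣≡∑𝟙∈ : ∀ {n} (p : Subset n) → ∣ p ∣ ≡ ∑[ i < n ] 𝟙 ⌊ i ∈? p ⌋
∣p∣≡∑𝟙∈ []            = refl
∣p∣≡∑𝟙∈ (true  ∷ p) = cong (1 +_) (≡.trans (∣p∣≡∑𝟙∈ p) (≡.sym (∑𝟙∈-∷ true p)))
∣p∣≡∑𝟙∈ (false ∷ p) = ≡.trans (∣p∣≡∑𝟙∈ p) (≡.sym (∑𝟙∈-∷ false p))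

4xy≤[x+y]²-ordered : ∀ {x y} → x ≤ y → 4 * (x * y) ≤ (x + y) * (x + y)
4xy≤[x+y]²-ordered {x} x≤y with m≤n⇒∃[o]m+o≡n x≤y
... | d , refl = subst (4 * (x * (x + d)) ≤_) (square-gap x d) (m≤m+n _ (d * d))
  where
  square-gap : ∀ x d → 4 * (x * (x + d)) + d * d ≡ (x + (x + d)) * (x + (x + d))
  square-gap = solve-∀

4xy≤[x+y]² : ∀ x y → 4 * (x * y) ≤ (x + y) * (x + y)
4xy≤[x+y]² x y with ≤-total x y
... | inj₁ x≤y = 4xy≤[x+y]²-ordered x≤y
... | inj₂ y≤x = subst₂ _≤_ (cong (4 *_) (*-comm y x)) (cong (λ z → z * z) (+-comm y x))
                   (4xy≤[x+y]²-ordered y≤x)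

inducedEdge : ∀ {n} → Graph n → Subset n → Fin n → Fin n → Bool
inducedEdge G S i j = ⌊ toℕ i <? toℕ j ⌋ ∧ ⌊ i ∈? S ⌋ ∧ ⌊ j ∈? S ⌋ ∧ adj G i j

-- The summand of edgesIn is local to Defs and cannot be named, so the left-hand
-- side of edgesIn-summand is left to unification with its use in edgesIn≡∑∑.
mutual
  edgesIn≡∑∑ : ∀ {n} (G : Graph n) (S : Subset n) →
    edgesIn G S ≡ ∑[ i < n ] ∑[ j < n ] 𝟙 (inducedEdge G S i j)
  edgesIn≡∑∑ {n} G S = begin
    edgesIn G S
      ≡⟨ cong List.sum (map-cong (λ i → cong List.sum (map-cong (edgesIn-summand G S i) (allFin n))) (allFin n)) ⟩
    List.sum (map (λ i → List.sum (map (λ j → 𝟙 (inducedEdge G S i j)) (allFin n))) (allFin n))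
      ≡⟨ ≡.trans (sum-map-tabulate {n = n} _ id) (sum-cong-≗ λ i → sum-map-tabulate (𝟙 ∘ inducedEdge G S i) id) ⟩
    ∑[ i < n ] ∑[ j < n ] 𝟙 (inducedEdge G S i j) ∎
    where open ≡-Reasoning

  edgesIn-summand : ∀ {n} (G : Graph n) (S : Subset n) (i j : Fin n) → _ ≡ 𝟙 (inducedEdge G S i j)
  edgesIn-summand G S i j with ⌊ toℕ i <? toℕ j ⌋ ∧ ⌊ i ∈? S ⌋ ∧ ⌊ j ∈? S ⌋ ∧ adj G i j
  ... | true  = refl
  ... | false = refl

m+m≤n+n⇒m≤n : ∀ {m n} → m + m ≤ n + n → m ≤ n
m+m≤n+n⇒m≤n m+m≤n+n = ≮⇒≥ λ n<m → <⇒≱ (+-mono-< n<m n<m) m+m≤n+n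

∑∑-distrib-+ : ∀ {m n} (f g : Fin m → Fin n → ℕ) →
  ∑[ i < m ] ∑[ j < n ] (f i j + g i j) ≡ ∑[ i < m ] ∑[ j < n ] f i j + ∑[ i < m ] ∑[ j < n ] g i j
∑∑-distrib-+ {m} {n} f g = ≡.trans (sum-cong-≗ λ i → ∑-distrib-+ (f i) (g i))
  (∑-distrib-+ (λ i → ∑[ j < n ] f i j) (λ i → ∑[ j < n ] g i j))

𝟙-ordered-pair≤ : ∀ l l′ s t a → (T l → T l′ → ⊥) →
  𝟙 (l ∧ s ∧ t ∧ a) + 𝟙 (l′ ∧ t ∧ s ∧ a) ≤ 𝟙 (s ∧ t ∧ a)
𝟙-ordered-pair≤ true  true  _     _     _ ¬both = ⊥-elim (¬both _ _)
𝟙-ordered-pair≤ true  false _     _     _ _     = ≤-reflexive (+-identityʳ _)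
𝟙-ordered-pair≤ false true  true  true  _ _     = ≤-refl
𝟙-ordered-pair≤ false true  true  false _ _     = z≤n
𝟙-ordered-pair≤ false true  false true  _ _     = z≤n
𝟙-ordered-pair≤ false true  false false _ _     = z≤n
𝟙-ordered-pair≤ false false _     _     _ _     = z≤n

𝟙-bichromatic≤ : ∀ s t a x y → (T s → T t → T a → x ≢ y) →
  𝟙 (s ∧ t ∧ a) ≤ 𝟙 (s ∧ x) * 𝟙 (t ∧ not y) + 𝟙 (s ∧ not x) * 𝟙 (t ∧ y)
𝟙-bichromatic≤ false _     _     _     _     _ = z≤n
𝟙-bichromatic≤ true  false _     _     _     _ = z≤n
𝟙-bichromatic≤ true  true  false _     _     _ = z≤n
𝟙-bichromatic≤ true  true  true  true  true  x≢y = ⊥-elim (x≢y _ _ _ refl)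
𝟙-bichromatic≤ true  true  true  false false x≢y = ⊥-elim (x≢y _ _ _ refl)
𝟙-bichromatic≤ true  true  true  true  false _   = ≤-refl
𝟙-bichromatic≤ true  true  true  false true  _   = ≤-refl

𝟙-∧-split : ∀ s x → 𝟙 (s ∧ x) + 𝟙 (s ∧ not x) ≡ 𝟙 s
𝟙-∧-split true  true  = refl
𝟙-∧-split true  false = refl
𝟙-∧-split false _     = refl

module _ {n} (G : Graph n) (S : Subset n) (b : Fin n → Bool)
         (b-proper : ∀ {i j} → i ∈ S → j ∈ S → T (adj G i j) → b i ≢ b j) where

  private
    inS : Fin n → Bool
    inS i = ⌊ i ∈? S ⌋

    trueSide falseSide : Fin n → ℕ
    trueSide  i = 𝟙 (inS i ∧ b i)
    falseSide i = 𝟙 (inS i ∧ not (b i))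

    inducedEdge-pair≤ : ∀ i j →
      𝟙 (inducedEdge G S i j) + 𝟙 (inducedEdge G S j i) ≤ trueSide i * falseSide j + falseSide i * trueSide j
    inducedEdge-pair≤ i j rewrite sym G j i = ≤-trans
      (𝟙-ordered-pair≤ ⌊ toℕ i <? toℕ j ⌋ ⌊ toℕ j <? toℕ i ⌋ (inS i) (inS j) (adj G i j)
        λ i<j j<i → <-asym (toWitness i<j) (toWitness j<i))
      (𝟙-bichromatic≤ (inS i) (inS j) (adj G i j) (b i) (b j)
        λ i∈S j∈S → b-proper (toWitness i∈S) (toWitness j∈S))

    x y : ℕ
    x = ∑[ i < n ] trueSide i
    y = ∑[ i < n ] falseSide i

    edgesIn≤x*y : edgesIn G S ≤ x * y
    edgesIn≤x*y = m+m≤n+n⇒m≤n (begin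
      edgesIn G S + edgesIn G S
        ≡⟨ cong₂ _+_ (edgesIn≡∑∑ G S) (≡.trans (edgesIn≡∑∑ G S) (∑-comm E)) ⟩
      ∑[ i < n ] ∑[ j < n ] E i j + ∑[ i < n ] ∑[ j < n ] E j i
        ≡⟨ ∑∑-distrib-+ E (λ i j → E j i) ⟨
      ∑[ i < n ] ∑[ j < n ] (E i j + E j i)
        ≤⟨ ∑-mono-≤ (λ i → ∑-mono-≤ (inducedEdge-pair≤ i)) ⟩
      ∑[ i < n ] ∑[ j < n ] (trueSide i * falseSide j + falseSide i * trueSide j)
        ≡⟨ ∑∑-distrib-+ (λ i j → trueSide i * falseSide j) (λ i j → falseSide i * trueSide j) ⟩
      ∑[ i < n ] ∑[ j < n ] (trueSide i * falseSide j) + ∑[ i < n ] ∑[ j < n ] (falseSide i * trueSide j)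
        ≡⟨ cong₂ _+_ (∑∑-product trueSide falseSide) (≡.trans (∑∑-product falseSide trueSide) (*-comm y x)) ⟩
      x * y + x * y ∎)
      where
      open ≤-Reasoning
      E : Fin n → Fin n → ℕ
      E i j = 𝟙 (inducedEdge G S i j)

    x+y≡∣S∣ : x + y ≡ ∣ S ∣
    x+y≡∣S∣ = ≡.trans (≡.sym (∑-distrib-+ trueSide falseSide))
      (≡.trans (sum-cong-≗ λ i → 𝟙-∧-split (inS i) (b i)) (≡.sym (∣p∣≡∑𝟙∈ S)))

  edgesIn-bipartite : 4 * edgesIn G S ≤ ∣ S ∣ * ∣ S ∣
  edgesIn-bipartite = begin
    4 * edgesIn G S   ≤⟨ *-monoʳ-≤ 4 edgesIn≤x*y ⟩
    4 * (x * y)       ≤⟨ 4xy≤[x+y]² x y ⟩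
    (x + y) * (x + y) ≡⟨ cong (λ z → z * z) x+y≡∣S∣ ⟩
    ∣ S ∣ * ∣ S ∣      ∎
    where open ≤-Reasoning

Fin2-≢-≢⇒≡ : ∀ {x y z : Fin 2} → x ≢ z → y ≢ z → x ≡ y
Fin2-≢-≢⇒≡ {zero}     {zero}     _   _   = refl
Fin2-≢-≢⇒≡ {suc zero} {suc zero} _   _   = refl
Fin2-≢-≢⇒≡ {zero}     {suc zero} {zero}     x≢z _   = ⊥-elim (x≢z refl)
Fin2-≢-≢⇒≡ {zero}     {suc zero} {suc zero} _   y≢z = ⊥-elim (y≢z refl)
Fin2-≢-≢⇒≡ {suc zero} {zero}     {zero}     _   y≢z = ⊥-elim (y≢z refl)
Fin2-≢-≢⇒≡ {suc zero} {zero}     {suc zero} x≢z _   = ⊥-elim (x≢z refl)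

Fin3-≢-≢⇒≡ : ∀ {p r x y : Fin 3} → r ≢ p → r ≢ x → r ≢ y → x ≢ p → y ≢ p → x ≡ y
Fin3-≢-≢⇒≡ r≢p r≢x r≢y x≢p y≢p = punchOut-injective r≢x r≢y
  (Fin2-≢-≢⇒≡ (x≢p ∘ punchOut-injective r≢x r≢p) (y≢p ∘ punchOut-injective r≢y r≢p))

edgesIn-avoiding-colour : ∀ {n} (G : Graph n) (c : Fin n → Fin 3) →
  (∀ i j → T (adj G i j) → c i ≢ c j) → (r : Fin 3) (S : Subset n) →
  (∀ {i} → i ∈ S → c i ≢ r) → 4 * edgesIn G S ≤ ∣ S ∣ * ∣ S ∣
edgesIn-avoiding-colour G c c-proper r S S-avoids-r = edgesIn-bipartite G S (λ i → ⌊ c i ≟ p ⌋) b-proper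
  where
  p : Fin 3
  p = punchIn r zero

  b-proper : ∀ {i j} → i ∈ S → j ∈ S → T (adj G i j) → ⌊ c i ≟ p ⌋ ≢ ⌊ c j ≟ p ⌋
  b-proper {i} {j} i∈S j∈S i~j with c i ≟ p | c j ≟ p
  ... | yes ci≡p | yes cj≡p = λ _ → c-proper i j i~j (≡.trans ci≡p (≡.sym cj≡p))
  ... | yes _    | no _     = λ ()
  ... | no _     | yes _    = λ ()
  ... | no ci≢p  | no cj≢p  = λ _ → c-proper i j i~j
    (Fin3-≢-≢⇒≡ (punchInᵢ≢i r zero ∘ ≡.sym) (S-avoids-r i∈S ∘ ≡.sym) (S-avoids-r j∈S ∘ ≡.sym) ci≢p cj≢p)

colourClass : ∀ {n m} → (Fin n → Fin m) → Fin m → Subset n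
colourClass c a = Vec.tabulate λ i → ⌊ c i ≟ a ⌋

module _ {n m} {c : Fin n → Fin m} {a : Fin m} where

  ∈-colourClass⁺ : ∀ {i} → c i ≡ a → i ∈ colourClass c a
  ∈-colourClass⁺ {i} ci≡a = lookup⇒[]= i _
    (≡.trans (lookup∘tabulate _ i) (Equivalence.to T-≡ (fromWitness ci≡a)))

  ∈-colourClass⁻ : ∀ {i} → i ∈ colourClass c a → c i ≡ a
  ∈-colourClass⁻ {i} i∈ = toWitness (Equivalence.from T-≡
    (≡.trans (≡.sym (lookup∘tabulate (λ j → ⌊ c j ≟ a ⌋) i)) ([]=⇒lookup i∈)))

colourClass⊆∁colourClass : ∀ {n m} (c : Fin n → Fin m) {u w} → u ≢ w →
  colourClass c u ⊆ ∁ (colourClass c w)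
colourClass⊆∁colourClass c u≢w i∈U = x∉p⇒x∈∁p λ i∈W →
  u≢w (≡.trans (≡.sym (∈-colourClass⁻ i∈U)) (∈-colourClass⁻ i∈W))

∣colourClass∣+∣colourClass∣≤n : ∀ {n m} (c : Fin n → Fin m) {u w} → u ≢ w →
  ∣ colourClass c u ∣ + ∣ colourClass c w ∣ ≤ n
∣colourClass∣+∣colourClass∣≤n {n} c {u} {w} u≢w = begin
  ∣ U ∣ + ∣ W ∣       ≤⟨ +-monoˡ-≤ ∣ W ∣ (p⊆q⇒∣p∣≤∣q∣ (colourClass⊆∁colourClass c u≢w)) ⟩
  ∣ ∁ W ∣ + ∣ W ∣     ≡⟨ cong (_+ ∣ W ∣) (∣∁p∣≡n∸∣p∣ W) ⟩
  (n ∸ ∣ W ∣) + ∣ W ∣ ≡⟨ m∸n+n≡m (∣p∣≤n W) ⟩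
  n                 ∎
  where
  open ≤-Reasoning
  U W : Subset n
  U = colourClass c u
  W = colourClass c w

∃-between-of-size : ∀ {n} (U V : Subset n) m → U ⊆ V → ∣ U ∣ ≤ m → m ≤ ∣ V ∣ →
  Σ (Subset n) λ A → U ⊆ A × A ⊆ V × ∣ A ∣ ≡ m
∃-between-of-size [] [] zero _ _ _ = [] , ⊆-refl , ⊆-refl , refl
∃-between-of-size (inside ∷ U) (outside ∷ V) m U⊆V _ _ with U⊆V here
... | ()
∃-between-of-size (outside ∷ U) (outside ∷ V) m U⊆V ∣U∣≤m m≤∣V∣ =
  let A , U⊆A , A⊆V , ∣A∣≡m = ∃-between-of-size U V m (drop-∷-⊆ U⊆V) ∣U∣≤m m≤∣V∣
  in outside ∷ A , s⊆s U⊆A , s⊆s A⊆V , ∣A∣≡m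
∃-between-of-size (inside ∷ U) (inside ∷ V) (suc m) U⊆V (s≤s ∣U∣≤m) (s≤s m≤∣V∣) =
  let A , U⊆A , A⊆V , ∣A∣≡m = ∃-between-of-size U V m (drop-∷-⊆ U⊆V) ∣U∣≤m m≤∣V∣
  in inside ∷ A , s⊆s U⊆A , s⊆s A⊆V , cong (1 +_) ∣A∣≡m
∃-between-of-size (outside ∷ U) (inside ∷ V) m U⊆V ∣U∣≤m m≤1+∣V∣ with m ≤? ∣ V ∣
... | yes m≤∣V∣ =
  let A , U⊆A , A⊆V , ∣A∣≡m = ∃-between-of-size U V m (drop-∷-⊆ U⊆V) ∣U∣≤m m≤∣V∣
  in outside ∷ A , s⊆s U⊆A , out⊆ A⊆V , ∣A∣≡m
∃-between-of-size (outside ∷ U) (inside ∷ V) zero U⊆V _ _ | no 0≰∣V∣ = ⊥-elim (0≰∣V∣ z≤n)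
∃-between-of-size (outside ∷ U) (inside ∷ V) (suc m) U⊆V _ (s≤s m≤∣V∣) | no 1+m≰∣V∣ =
  let ∣V∣≤m = ≤-pred (≰⇒> 1+m≰∣V∣)
      A , U⊆A , A⊆V , ∣A∣≡m = ∃-between-of-size U V m (drop-∷-⊆ U⊆V)
        (≤-trans (p⊆q⇒∣p∣≤∣q∣ (drop-∷-⊆ U⊆V)) ∣V∣≤m) m≤∣V∣
  in inside ∷ A , out⊆ U⊆A , s⊆s A⊆V , cong (1 +_) ∣A∣≡m

∣p∣≡k⇒∣∁p∣≡k : ∀ {k} (p : Subset (k + k)) → ∣ p ∣ ≡ k → ∣ ∁ p ∣ ≡ k
∣p∣≡k⇒∣∁p∣≡k {k} p ∣p∣≡k = begin
  ∣ ∁ p ∣        ≡⟨ ∣∁p∣≡n∸∣p∣ p ⟩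
  k + k ∸ ∣ p ∣  ≡⟨ cong (k + k ∸_) ∣p∣≡k ⟩
  k + k ∸ k     ≡⟨ m+n∸n≡m k k ⟩
  k             ∎
  where open ≡-Reasoning

∣p∣≤k⇒k≤∣∁p∣ : ∀ {k} (p : Subset (k + k)) → ∣ p ∣ ≤ k → k ≤ ∣ ∁ p ∣
∣p∣≤k⇒k≤∣∁p∣ {k} p ∣p∣≤k = begin
  k             ≡⟨ m+n∸n≡m k k ⟨
  k + k ∸ k     ≤⟨ ∸-monoʳ-≤ (k + k) ∣p∣≤k ⟩
  k + k ∸ ∣ p ∣  ≡⟨ ∣∁p∣≡n∸∣p∣ p ⟨
  ∣ ∁ p ∣        ∎
  where open ≤-Reasoning

balanced-split : ∀ {m} k (c : Fin (k + k) → Fin m) {u w} → u ≢ w →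
  ∣ colourClass c u ∣ ≤ k → ∣ colourClass c w ∣ ≤ k →
  Σ (Subset (k + k)) λ A → ∣ A ∣ ≡ k × ∣ ∁ A ∣ ≡ k ×
    (∀ {i} → i ∈ A → c i ≢ w) × (∀ {i} → i ∈ ∁ A → c i ≢ u)
balanced-split k c {u} {w} u≢w ∣U∣≤k ∣W∣≤k =
  let A , U⊆A , A⊆∁W , ∣A∣≡k = ∃-between-of-size (colourClass c u) (∁ (colourClass c w)) k
        (colourClass⊆∁colourClass c u≢w) ∣U∣≤k (∣p∣≤k⇒k≤∣∁p∣ (colourClass c w) ∣W∣≤k)
  in A , ∣A∣≡k , ∣p∣≡k⇒∣∁p∣≡k A ∣A∣≡k ,
     (λ i∈A ci≡w → x∈∁p⇒x∉p (A⊆∁W i∈A) (∈-colourClass⁺ ci≡w)) ,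
     (λ i∈∁A ci≡u → x∈∁p⇒x∉p i∈∁A (U⊆A (∈-colourClass⁺ ci≡u)))

large-colourClass⇒small : ∀ {m} k (c : Fin (k + k) → Fin m) {u w} → u ≢ w →
  ∣ colourClass c u ∣ ≰ k → ∣ colourClass c w ∣ ≤ k
large-colourClass⇒small k c u≢w large = ≮⇒≥ λ k<∣W∣ →
  <⇒≱ (+-mono-< (≰⇒> large) k<∣W∣) (∣colourClass∣+∣colourClass∣≤n c u≢w)

two-small-colours : ∀ k (c : Fin (k + k) → Fin 3) →
  Σ (Fin 3) λ u → Σ (Fin 3) λ w → u ≢ w × ∣ colourClass c u ∣ ≤ k × ∣ colourClass c w ∣ ≤ k
two-small-colours k c with ∣ colourClass c 0F ∣ ≤? k | ∣ colourClass c 1F ∣ ≤? k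
... | yes small₀ | yes small₁ = 0F , 1F , (λ ()) , small₀ , small₁
... | yes small₀ | no  large₁ = 0F , 2F , (λ ()) , small₀ , large-colourClass⇒small k c (λ ()) large₁
... | no  large₀ | _          = 1F , 2F , (λ ()) , large-colourClass⇒small k c (λ ()) large₀ ,
                                                 large-colourClass⇒small k c (λ ()) large₀

4e≤k²⇒16e≤[k+k]² : ∀ e k → 4 * e ≤ k * k → 16 * e ≤ (k + k) * (k + k)
4e≤k²⇒16e≤[k+k]² e k 4e≤k² = begin
  16 * e          ≡⟨ *-assoc 4 4 e ⟩
  4 * (4 * e)     ≤⟨ *-monoʳ-≤ 4 4e≤k² ⟩
  4 * (k * k)     ≡⟨ [k+k]²≡4k² k ⟨
  (k + k) * (k + k) ∎
  where
  open ≤-Reasoning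
  [k+k]²≡4k² : ∀ k → (k + k) * (k + k) ≡ 4 * (k * k)
  [k+k]²≡4k² = solve-∀

proposition2p7 : (k : ℕ) → (G : Graph (k + k)) → ThreePartite G →
    Σ (Subset (k + k)) λ A →
      (∣ A ∣ ≡ k) × (∣ ∁ A ∣ ≡ k) ×
      (16 * edgesIn G A ≤ (k + k) * (k + k)) ×
      (16 * edgesIn G (∁ A) ≤ (k + k) * (k + k))
proposition2p7 k G (c , c-proper) =
  let u , w , u≢w , small-u , small-w = two-small-colours k c
      A , ∣A∣≡k , ∣∁A∣≡k , A-avoids-w , ∁A-avoids-u = balanced-split k c u≢w small-u small-w
  in A , ∣A∣≡k , ∣∁A∣≡k , half-bound A w ∣A∣≡k A-avoids-w , half-bound (∁ A) u ∣∁A∣≡k ∁A-avoids-u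
  where
  half-bound : ∀ S r → ∣ S ∣ ≡ k → (∀ {i} → i ∈ S → c i ≢ r) →
    16 * edgesIn G S ≤ (k + k) * (k + k)
  half-bound S r ∣S∣≡k S-avoids-r = 4e≤k²⇒16e≤[k+k]² (edgesIn G S) k
    (subst (λ s → 4 * edgesIn G S ≤ s * s) ∣S∣≡k (edgesIn-avoiding-colour G c c-proper r S S-avoids-r))
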